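{- Let $\tau$ be a $132$-avoiding permutation and let $\pi=\mathrm{swl}(\tau)$. Order the $\mathrm{nw}$ stripes of $\pi$ by height. Then the lowest $\mathrm{nw}$ stripe of $\pi$ consists only of images of left-to-right minima of $\tau$, and each other $\mathrm{nw}$ stripe of $\pi$ contains exactly one element that is not the image of a left-to-right minimum of $\tau$, this element being the rightmost point of that stripe.
   Context: For $\pi\in S_n$, its plot is $\{(i,\pi_i)\}$. Three indices $a<b<c$ form a $132$ pattern if $\pi_a<\pi_c<\pi_b$ and a $312$ pattern if $\pi_b<\pi_c<\pi_a$. For $i\in[n]$ let $(m,\pi_m)$ be the point with $\pi_m=i$, let $B$ (resp. $T$) be the subsequence of $\pi_1\cdots\pi_{m-1}$ of entries less than (resp. greater than) $i$, and set $\mathrm{swl}_i(\pi)=B\,T\,\pi_m\pi_{m+1}\cdots\pi_n$. Define $\mathrm{swl}=\mathrm{swl}_1\circ\cdots\circ\mathrm{swl}_n$; it maps $132$-avoiding permutations to $312$-avoiding permutations. The image of the point of $\tau$ with height $h$ is the point of $\mathrm{swl}(\tau)$ with height $h$. A point is a left-to-right maximum (minimum) if no point to its left is strictly higher (lower). For a $312$-avoiding $\pi$ and a point $(i,\pi_i)$, $\mathrm{nw}(i,\pi_i)$ is the leftmost left-to-right maximum $(j,\pi_j)$ with $j\leq i$ and $\pi_j\geq\pi_i$; the $\mathrm{nw}$ stripe of a point $p$ is $\{q:\mathrm{nw}(q)=\mathrm{nw}(p)\}$. For left-to-right maxima $p$ below $p'$, every point of the stripe of $p$ is below every point of the stripe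 of $p'$, so stripes are totally ordered by height. -}

module Defs where

open import Data.Nat using (ℕ; zero; suc; _<_; _≤_; _<?_; _≟_)
open import Data.List using (List; []; _∷_; length; filter; span; foldr; map; upTo; _++_)
open import Data.List.Relation.Binary.Permutation.Propositional using (_↭_)
open import Data.Product using (_×_; _,_; ∃-syntax)
open import Relation.Nullary using (¬_; ¬?)
open import Relation.Binary.PropositionalEquality using (_≡_)

-- A permutation of [n] = {1,…,n} is a list of length n that is a
-- rearrangement of 1,…,n.  Positions are 0-based list indices.
IsPerm : List ℕ → Set
IsPerm xs = xs ↭ map suc (upTo (length xs))

-- entry at (0-based) position k; default 0 outside range (always guarded)
at : List ℕ → ℕ → ℕ
at []       _       = 0
at (x ∷ _)  zero    = x
at (_ ∷ xs) (suc k) = at xs k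

Avoids132 : List ℕ → Set
Avoids132 xs = ∀ a b c → a < b → b < c → c < length xs →
  ¬ (at xs a < at xs c × at xs c < at xs b)

swlStep : ℕ → List ℕ → List ℕ
swlStep i xs with span (λ x → ¬? (x ≟ i)) xs
... | pre , rest = filter (_<? i) pre ++ filter (i <?_) pre ++ rest

-- swl = swl_1 ∘ swl_2 ∘ ⋯ ∘ swl_n   (swl_n applied first)
swl : List ℕ → List ℕ
swl xs = foldr swlStep xs (map suc (upTo (length xs)))

LRMax : List ℕ → ℕ → Set
LRMax xs j = j < length xs × (∀ k → k < j → at xs k ≤ at xs j)

LRMin : List ℕ → ℕ → Set
LRMin xs j = j < length xs × (∀ k → k < j → at xs j ≤ at xs k)

-- NW xs i j : nw(i, π_i) = (j, π_j), i.e. j is the leftmost left-to-right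
-- maximum with j ≤ i and π_j ≥ π_i
NW : List ℕ → ℕ → ℕ → Set
NW xs i j = i < length xs × LRMax xs j × j ≤ i × at xs i ≤ at xs j ×
  (∀ j′ → j′ < j → LRMax xs j′ → ¬ (at xs i ≤ at xs j′))

-- j is the head of an nw stripe (the stripe {q : NW xs q j})
StripeHead : List ℕ → ℕ → Set
StripeHead xs j = NW xs j j

-- the point at position q of π = swl τ is the image of a left-to-right
-- minimum of τ (the image of a point has the same height)
ImgLRMin : List ℕ → List ℕ → ℕ → Set
ImgLRMin τ π q = ∃[ p ] (at τ p ≡ at π q × LRMin τ p)

module Submission where

-- Let τ be 132-avoiding with last entry k.  No entry below k
-- can precede an entry above k (together with k they would form a 132), so
-- τ = δ ++ α ++ [k] with every entry of δ above k and every entry of α below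
-- k.  The steps swl_i commute with appending entries to the right of the
-- value i, and swl_k brings the entries below k to the front, hence
-- swl τ = swl α ++ swl δ ++ [k], where swl α (swl δ) runs over the values
-- below (above) k only.  The left-to-right minima of τ are those of δ,
-- those of α, and k exactly when α is empty.
--
-- Call a point of π marked if it is the image of a left-to-right minimum of
-- τ.  The invariant carried through the induction is StripeShape: the nw
-- stripe headed at position 0 is entirely marked, and every other stripe has
-- exactly one unmarked point, namely its rightmost one.  For π = A ++ B ++ [k]
-- with A below k below B, this shape is inherited from A and B: if A = [],
-- then k is marked and joins the bottom stripe of B; otherwise the stripes of
-- π are those of A followed by those of B ++ [k], in which the unmarked k is
-- the last point of the stripe headed at the first entry of B.

open import Defs
open import Data.Nat using (ℕ; zero; suc; _<_; _≤_; _≥_; _+_; _∸_; z≤n; s≤s; _<?_; _≟_; _≡ᵇ_)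
open import Data.Nat.Properties
open import Data.List using (List; []; _∷_; [_]; _∷ʳ_; length; _++_; filter; span; foldr; map; upTo; initLast; _∷ʳ′_)
open import Data.List.Properties using (length-++; length-++-≤ˡ; foldr-++; filter-++; filter-all; filter-none; filter-accept; filter-reject; ++-assoc; ++-identityʳ)
open import Data.List.Relation.Unary.All using (All; []; _∷_)
import Data.List.Relation.Unary.All as All
import Data.List.Relation.Unary.All.Properties as AllP
open import Data.List.Relation.Unary.AllPairs using (AllPairs; []; _∷_)
import Data.List.Relation.Unary.AllPairs as AllPairs
import Data.List.Relation.Unary.AllPairs.Properties as AllPairsP
open import Data.List.Relation.Unary.Unique.Propositional using (Unique)
open import Data.List.Relation.Unary.Any using (here; there)
open import Data.List.Relation.Binary.Permutation.Propositional using (↭-sym; ↭⇒↭ₛ)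
open import Data.List.Relation.Binary.Permutation.Propositional.Properties using (∈-resp-↭)
open import Data.List.Membership.Propositional using (_∈_)
open import Data.List.Membership.Propositional.Properties using (∈-++⁻; ∈-++⁺ˡ; ∈-++⁺ʳ; ∈-filter⁺; ∈-filter⁻)
open import Data.Product using (_×_; _,_; ∃-syntax; proj₁; proj₂; Σ)
open import Data.Sum using (_⊎_; inj₁; inj₂)
open import Data.Empty using (⊥; ⊥-elim)
open import Data.Bool using (true; false; T)
open import Data.Unit using (tt)
open import Relation.Nullary using (¬_; Dec; yes; no; ¬?)
open import Relation.Unary using (Decidable)
open import Relation.Binary.Definitions using (tri<; tri≈; tri>)
open import Relation.Binary.PropositionalEquality using (_≡_; refl; sym; trans; cong; subst; subst₂; module ≡-Reasoning)
open import Relation.Binary.PropositionalEquality.Properties using (setoid)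
open import Data.List.Relation.Binary.Permutation.Setoid.Properties (setoid ℕ) using (Unique-resp-↭)

at-++ˡ : ∀ xs ys q → q < length xs → at (xs ++ ys) q ≡ at xs q
at-++ˡ (x ∷ xs) ys zero    _       = refl
at-++ˡ (x ∷ xs) ys (suc q) (s≤s p) = at-++ˡ xs ys q p

at-++ʳ : ∀ xs ys q → at (xs ++ ys) (length xs + q) ≡ at ys q
at-++ʳ []       ys q = refl
at-++ʳ (x ∷ xs) ys q = at-++ʳ xs ys q

at-∷ʳ : ∀ xs k → at (xs ∷ʳ k) (length xs) ≡ k
at-∷ʳ []       k = refl
at-∷ʳ (x ∷ xs) k = at-∷ʳ xs k

length-∷ʳ : ∀ (xs : List ℕ) k → length (xs ∷ʳ k) ≡ suc (length xs)
length-∷ʳ []       k = refl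
length-∷ʳ (x ∷ xs) k = cong suc (length-∷ʳ xs k)

at-All : ∀ {P : ℕ → Set} xs q → All P xs → q < length xs → P (at xs q)
at-All (x ∷ xs) zero    (px ∷ _)   _       = px
at-All (x ∷ xs) (suc q) (_ ∷ pxs) (s≤s p) = at-All xs q pxs p

at-∈ : ∀ xs q → q < length xs → at xs q ∈ xs
at-∈ (x ∷ xs) zero    _       = here refl
at-∈ (x ∷ xs) (suc q) (s≤s p) = there (at-∈ xs q p)

∈⇒nonEmpty : ∀ {x : ℕ} {xs} → x ∈ xs → 0 < length xs
∈⇒nonEmpty (here _)  = s≤s z≤n
∈⇒nonEmpty (there _) = s≤s z≤n

≤⇒offset : ∀ m q → m ≤ q → ∃[ r ] (q ≡ m + r)
≤⇒offset m q m≤q = q ∸ m , sym (m+[n∸m]≡n m≤q)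

offset-<⁻ : ∀ (xs ys : List ℕ) r → length xs + r < length (xs ++ ys) → r < length ys
offset-<⁻ xs ys r p = +-cancelˡ-< (length xs) r (length ys) (subst (length xs + r <_) (length-++ xs) p)

offset-<⁺ : ∀ (xs ys : List ℕ) r → r < length ys → length xs + r < length (xs ++ ys)
offset-<⁺ xs ys r p = subst (length xs + r <_) (sym (length-++ xs)) (+-monoʳ-< (length xs) p)

<-∷ʳ-split : ∀ (xs : List ℕ) k q → q < length (xs ∷ʳ k) → q < length xs ⊎ q ≡ length xs
<-∷ʳ-split xs k q p = m<1+n⇒m<n∨m≡n (subst (q <_) (length-∷ʳ xs k) p)

-- "Every earlier entry is R-related to entry j".  LRMax xs j is definitionally
-- LeftToRight _≤_ xs j and LRMin xs j is LeftToRight _≥_ xs j, so the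
-- concatenation lemmas below serve both.
LeftToRight : (ℕ → ℕ → Set) → List ℕ → ℕ → Set
LeftToRight R xs j = j < length xs × (∀ k → k < j → R (at xs k) (at xs j))

LR-prefix⁻ : ∀ {R} xs ys j → j < length xs → LeftToRight R (xs ++ ys) j → LeftToRight R xs j
LR-prefix⁻ {R} xs ys j jl (_ , earlier) = jl , λ k k<j →
  subst₂ R (at-++ˡ xs ys k (<-trans k<j jl)) (at-++ˡ xs ys j jl) (earlier k k<j)

LR-prefix⁺ : ∀ {R} xs ys j → LeftToRight R xs j → LeftToRight R (xs ++ ys) j
LR-prefix⁺ {R} xs ys j (jl , earlier) = <-≤-trans jl (length-++-≤ˡ xs) , λ k k<j →
  subst₂ R (sym (at-++ˡ xs ys k (<-trans k<j jl))) (sym (at-++ˡ xs ys j jl)) (earlier k k<j)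

LR-suffix⁻ : ∀ {R} xs ys j → LeftToRight R (xs ++ ys) (length xs + j) → LeftToRight R ys j
LR-suffix⁻ {R} xs ys j (jl , earlier) = offset-<⁻ xs ys j jl , λ k k<j →
  subst₂ R (at-++ʳ xs ys k) (at-++ʳ xs ys j) (earlier (length xs + k) (+-monoʳ-< (length xs) k<j))

LR-suffix⁺ : ∀ {R} xs ys j → (∀ a b → a < length xs → b < length ys → R (at xs a) (at ys b)) →
  LeftToRight R ys j → LeftToRight R (xs ++ ys) (length xs + j)
LR-suffix⁺ {R} xs ys j across (jl , earlier) = offset-<⁺ xs ys j jl , before
  where
  before : ∀ k → k < length xs + j → R (at (xs ++ ys) k) (at (xs ++ ys) (length xs + j))
  before k k< with k <? length xs
  ... | yes kl = subst₂ R (sym (at-++ˡ xs ys k kl)) (sym (at-++ʳ xs ys j)) (across k j kl jl)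
  ... | no kl with ≤⇒offset (length xs) k (≮⇒≥ kl)
  ... | r , refl = subst₂ R (sym (at-++ʳ xs ys r)) (sym (at-++ʳ xs ys j))
                     (earlier r (+-cancelˡ-< (length xs) r j k<))

LRMax-first : ∀ xs → 0 < length xs → LRMax xs 0
LRMax-first xs p = p , λ _ ()

first≤LRMax : ∀ xs j → LRMax xs j → at xs 0 ≤ at xs j
first≤LRMax xs zero    _              = ≤-refl
first≤LRMax xs (suc j) (_ , earlier) = earlier 0 (s≤s z≤n)

Below : List ℕ → List ℕ → Set
Below xs ys = ∀ a b → a < length xs → b < length ys → at xs a < at ys b

NW-inRange : ∀ xs {q j} → NW xs q j → q < length xs
NW-inRange _ (ql , _) = ql

NW-head≤ : ∀ xs {q j} → NW xs q j → j ≤ q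
NW-head≤ _ (_ , _ , j≤q , _) = j≤q

NW-prefix⁻ : ∀ xs ys q j → q < length xs → NW (xs ++ ys) q j → NW xs q j
NW-prefix⁻ xs ys q j ql (_ , lrmax , j≤q , underHead , leftmost) =
  ql , LR-prefix⁻ {_≤_} xs ys j jl lrmax , j≤q ,
  subst₂ _≤_ (at-++ˡ xs ys q ql) (at-++ˡ xs ys j jl) underHead ,
  λ j′ j′<j lrmax′ le → leftmost j′ j′<j (LR-prefix⁺ {_≤_} xs ys j′ lrmax′)
     (subst₂ _≤_ (sym (at-++ˡ xs ys q ql)) (sym (at-++ˡ xs ys j′ (<-trans j′<j jl))) le)
  where jl = ≤-<-trans j≤q ql

NW-prefix⁺ : ∀ xs ys q j → NW xs q j → NW (xs ++ ys) q j
NW-prefix⁺ xs ys q j (ql , lrmax , j≤q , underHead , leftmost) =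
  <-≤-trans ql (length-++-≤ˡ xs) , LR-prefix⁺ {_≤_} xs ys j lrmax , j≤q ,
  subst₂ _≤_ (sym (at-++ˡ xs ys q ql)) (sym (at-++ˡ xs ys j jl)) underHead ,
  λ j′ j′<j lrmax′ le → leftmost j′ j′<j (LR-prefix⁻ {_≤_} xs ys j′ (<-trans j′<j jl) lrmax′)
     (subst₂ _≤_ (at-++ˡ xs ys q ql) (at-++ˡ xs ys j′ (<-trans j′<j jl)) le)
  where jl = ≤-<-trans j≤q ql

NW-suffixHead : ∀ xs ys q j → Below xs ys → NW (xs ++ ys) q j → length xs ≤ q → length xs ≤ j
NW-suffixHead xs ys q j below (ql , _ , _ , underHead , _) xs≤q with j <? length xs
... | no jl = ≮⇒≥ jl
... | yes jl with ≤⇒offset (length xs) q xs≤q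
... | r , refl = ⊥-elim (<⇒≱ (below j r jl (offset-<⁻ xs ys r ql))
                  (subst₂ _≤_ (at-++ʳ xs ys r) (at-++ˡ xs ys j jl) underHead))

NW-suffix⁻ : ∀ xs ys q j → Below xs ys → NW (xs ++ ys) (length xs + q) (length xs + j) → NW ys q j
NW-suffix⁻ xs ys q j below (ql , lrmax , j≤q , underHead , leftmost) =
  offset-<⁻ xs ys q ql , LR-suffix⁻ {_≤_} xs ys j lrmax , +-cancelˡ-≤ (length xs) j q j≤q ,
  subst₂ _≤_ (at-++ʳ xs ys q) (at-++ʳ xs ys j) underHead ,
  λ j′ j′<j lrmax′ le → leftmost (length xs + j′) (+-monoʳ-< (length xs) j′<j)
     (LR-suffix⁺ {_≤_} xs ys j′ (λ a b al bl → <⇒≤ (below a b al bl)) lrmax′)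
     (subst₂ _≤_ (sym (at-++ʳ xs ys q)) (sym (at-++ʳ xs ys j′)) le)

NW-suffix⁺ : ∀ xs ys q j → Below xs ys → NW ys q j → NW (xs ++ ys) (length xs + q) (length xs + j)
NW-suffix⁺ xs ys q j below (ql , lrmax , j≤q , underHead , leftmost) =
  offset-<⁺ xs ys q ql , LR-suffix⁺ {_≤_} xs ys j (λ a b al bl → <⇒≤ (below a b al bl)) lrmax ,
  +-monoʳ-≤ (length xs) j≤q ,
  subst₂ _≤_ (sym (at-++ʳ xs ys q)) (sym (at-++ʳ xs ys j)) underHead , leftmost′
  where
  leftmost′ : ∀ j″ → j″ < length xs + j → LRMax (xs ++ ys) j″ →
      ¬ (at (xs ++ ys) (length xs + q) ≤ at (xs ++ ys) j″)
  leftmost′ j″ lt lrmax″ le with j″ <? length xs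
  ... | yes jl = <⇒≱ (below j″ q jl ql) (subst₂ _≤_ (at-++ʳ xs ys q) (at-++ˡ xs ys j″ jl) le)
  ... | no jl with ≤⇒offset (length xs) j″ (≮⇒≥ jl)
  ... | r , refl = leftmost r (+-cancelˡ-< (length xs) r j lt) (LR-suffix⁻ {_≤_} xs ys r lrmax″)
                     (subst₂ _≤_ (at-++ʳ xs ys q) (at-++ʳ xs ys r) le)

NW-lowLast⁺ : ∀ B k → All (k <_) B → NW (B ∷ʳ k) (length B) 0
NW-lowLast⁺ []      k _        = s≤s z≤n , LRMax-first [ k ] (s≤s z≤n) , z≤n , ≤-refl , λ _ ()
NW-lowLast⁺ (b ∷ B) k (k<b ∷ _) =
  subst (suc (length B) <_) (sym (length-∷ʳ (b ∷ B) k)) ≤-refl ,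
  LRMax-first (b ∷ B ∷ʳ k) (s≤s z≤n) , z≤n ,
  subst (_≤ b) (sym (at-∷ʳ (b ∷ B) k)) (<⇒≤ k<b) , λ _ ()

NW-lowLast⁻ : ∀ B k j → All (k <_) B → NW (B ∷ʳ k) (length B) j → j ≡ 0
NW-lowLast⁻ B       k zero    _         _                            = refl
NW-lowLast⁻ []      k (suc j) _         (_ , _ , () , _)
NW-lowLast⁻ (b ∷ B) k (suc j) (k<b ∷ _) (_ , _ , _ , _ , leftmost) =
  ⊥-elim (leftmost 0 (s≤s z≤n) (LRMax-first (b ∷ B ∷ʳ k) (s≤s z≤n))
    (subst (_≤ b) (sym (at-∷ʳ (b ∷ B) k)) (<⇒≤ k<b)))

NW-lowLast-higher : ∀ B k q j → All (k <_) B → 0 < j → NW (B ∷ʳ k) q j → NW B q j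
NW-lowLast-higher B k q j k<B 0<j nw with <-∷ʳ-split B k q (NW-inRange (B ∷ʳ k) nw)
... | inj₁ ql   = NW-prefix⁻ B [ k ] q j ql nw
... | inj₂ refl with NW-lowLast⁻ B k j k<B nw
NW-lowLast-higher B k q .0 k<B () nw | inj₂ refl | refl

-- The stripe-shape invariant, for a predicate M on values ("marked").

AllMarked : List ℕ → (ℕ → Set) → ℕ → Set
AllMarked π M j = ∀ q → NW π q j → M (at π q)

LastUnmarked : List ℕ → (ℕ → Set) → ℕ → Set
LastUnmarked π M j = ∃[ q ] (NW π q j × ¬ M (at π q) ×
  (∀ q′ → NW π q′ j → ¬ M (at π q′) → q′ ≡ q) × (∀ q′ → NW π q′ j → q′ ≤ q))

StripeShape : List ℕ → (ℕ → Set) → Set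
StripeShape π M = AllMarked π M 0 × (∀ j → StripeHead π j → 0 < j → LastUnmarked π M j)

-- The shape of the part of π to the right of a low block A.
AllLastUnmarked : List ℕ → (ℕ → Set) → Set
AllLastUnmarked π M = ∀ j → StripeHead π j → LastUnmarked π M j

lastUnmarked-shift : ∀ {π ρ M j j′} o → (∀ q → NW ρ q j′ → NW π (o + q) j) →
  (∀ q → NW ρ q j′ → at π (o + q) ≡ at ρ q) →
  (∀ q → NW π q j → ∃[ r ] (q ≡ o + r × NW ρ r j′)) → LastUnmarked ρ M j′ → LastUnmarked π M j
lastUnmarked-shift {π} {ρ} {M} {j} {j′} o to same from (q , nw , unmarked , unique , rightmost) =
  o + q , to q nw , (λ m → unmarked (subst M (same q nw) m)) , unique′ , rightmost′
  where
  unique′ : ∀ q′ → NW π q′ j → ¬ M (at π q′) → q′ ≡ o + q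
  unique′ q′ nw′ unmarked′ with from q′ nw′
  ... | r , refl , nwr = cong (o +_) (unique r nwr (λ m → unmarked′ (subst M (sym (same r nwr)) m)))
  rightmost′ : ∀ q′ → NW π q′ j → q′ ≤ o + q
  rightmost′ q′ nw′ with from q′ nw′
  ... | r , refl , nwr = +-monoʳ-≤ o (rightmost r nwr)

shape-respects : ∀ π (M M′ : ℕ → Set) → (∀ {v} → v ∈ π → M v → M′ v) →
  (∀ {v} → v ∈ π → M′ v → M v) → StripeShape π M → StripeShape π M′
shape-respects π M M′ to from (bottom , higher) =
  (λ q nw → to (entry nw) (bottom q nw)) , λ j head 0<j → transfer j (higher j head 0<j)
  where
  entry : ∀ {q j} → NW π q j → at π q ∈ π
  entry {q} nw = at-∈ π q (NW-inRange π nw)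
  transfer : ∀ j → LastUnmarked π M j → LastUnmarked π M′ j
  transfer j (q , nw , unmarked , unique , rightmost) =
    q , nw , (λ m → unmarked (from (entry nw) m)) ,
    (λ q′ nw′ unmarked′ → unique q′ nw′ (λ m → unmarked′ (to (entry nw′) m))) , rightmost

shape-[] : ∀ M → StripeShape [] M
shape-[] M = (λ q nw → ⊥-elim (n≮0 (NW-inRange [] nw))) , λ j head _ → ⊥-elim (n≮0 (NW-inRange [] head))

lowLast-higherStripes : ∀ B k M → All (k <_) B → StripeShape B M → ∀ j → StripeHead (B ∷ʳ k) j →
  0 < j → LastUnmarked (B ∷ʳ k) M j
lowLast-higherStripes B k M k<B (_ , higher) j head 0<j =
  lastUnmarked-shift {B ∷ʳ k} {B} {M} {j} {j} 0 (λ q nw → NW-prefix⁺ B [ k ] q j nw)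
    (λ q nw → at-++ˡ B [ k ] q (NW-inRange B nw))
    (λ q nw → q , refl , NW-lowLast-higher B k q j k<B 0<j nw)
    (higher j (NW-lowLast-higher B k j j k<B 0<j head) 0<j)

shape-lowMarked : ∀ B k M → All (k <_) B → StripeShape B M → M k → StripeShape (B ∷ʳ k) M
shape-lowMarked B k M k<B shapeB@(bottom , _) marked =
  bottom′ , lowLast-higherStripes B k M k<B shapeB
  where
  bottom′ : AllMarked (B ∷ʳ k) M 0
  bottom′ q nw with <-∷ʳ-split B k q (NW-inRange (B ∷ʳ k) nw)
  ... | inj₁ ql   = subst M (sym (at-++ˡ B [ k ] q ql)) (bottom q (NW-prefix⁻ B [ k ] q 0 ql nw))
  ... | inj₂ refl = subst M (sym (at-∷ʳ B k)) marked

lowUnmarked-allLast : ∀ B k M → All (k <_) B → StripeShape B M → ¬ M k → AllLastUnmarked (B ∷ʳ k) M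
lowUnmarked-allLast B k M k<B (bottom , _) unmarked zero _ =
  length B , NW-lowLast⁺ B k k<B , (λ m → unmarked (subst M (at-∷ʳ B k) m)) , unique , rightmost
  where
  unique : ∀ q′ → NW (B ∷ʳ k) q′ 0 → ¬ M (at (B ∷ʳ k) q′) → q′ ≡ length B
  unique q′ nw unmarked′ with <-∷ʳ-split B k q′ (NW-inRange (B ∷ʳ k) nw)
  ... | inj₁ ql = ⊥-elim (unmarked′ (subst M (sym (at-++ˡ B [ k ] q′ ql))
                    (bottom q′ (NW-prefix⁻ B [ k ] q′ 0 ql nw))))
  ... | inj₂ e  = e
  rightmost : ∀ q′ → NW (B ∷ʳ k) q′ 0 → q′ ≤ length B
  rightmost q′ nw with <-∷ʳ-split B k q′ (NW-inRange (B ∷ʳ k) nw)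
  ... | inj₁ ql   = <⇒≤ ql
  ... | inj₂ refl = ≤-refl
lowUnmarked-allLast B k M k<B shapeB unmarked (suc j) head =
  lowLast-higherStripes B k M k<B shapeB (suc j) head (s≤s z≤n)

shape-++ : ∀ A C M → Below A C → 0 < length A → StripeShape A M → AllLastUnmarked C M →
  StripeShape (A ++ C) M
shape-++ A C M below 0<A (bottomA , higherA) allC = bottom , higher
  where
  bottom : AllMarked (A ++ C) M 0
  bottom q nw with q <? length A
  ... | yes ql = subst M (sym (at-++ˡ A C q ql)) (bottomA q (NW-prefix⁻ A C q 0 ql nw))
  ... | no ql  = ⊥-elim (<⇒≱ 0<A (NW-suffixHead A C q 0 below nw (≮⇒≥ ql)))
  higher : ∀ j → StripeHead (A ++ C) j → 0 < j → LastUnmarked (A ++ C) M j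
  higher j head 0<j with j <? length A
  ... | yes jl = lastUnmarked-shift {A ++ C} {A} {M} {j} {j} 0 (λ q nw → NW-prefix⁺ A C q j nw)
         (λ q nw → at-++ˡ A C q (NW-inRange A nw)) fromA (higherA j (NW-prefix⁻ A C j j jl head) 0<j)
    where
    fromA : ∀ q → NW (A ++ C) q j → ∃[ r ] (q ≡ 0 + r × NW A r j)
    fromA q nw with q <? length A
    ... | yes ql = q , refl , NW-prefix⁻ A C q j ql nw
    ... | no ql  = ⊥-elim (<⇒≱ jl (NW-suffixHead A C q j below nw (≮⇒≥ ql)))
  ... | no jl with ≤⇒offset (length A) j (≮⇒≥ jl)
  ... | j′ , refl = lastUnmarked-shift {A ++ C} {C} {M} {length A + j′} {j′} (length A)
         (λ q nw → NW-suffix⁺ A C q j′ below nw) (λ q nw → at-++ʳ A C q) fromC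
         (allC j′ (NW-suffix⁻ A C j′ j′ below head))
    where
    fromC : ∀ q → NW (A ++ C) q (length A + j′) → ∃[ r ] (q ≡ length A + r × NW C r j′)
    fromC q nw with ≤⇒offset (length A) q (≤-trans (m≤m+n (length A) j′) (NW-head≤ (A ++ C) nw))
    ... | r , refl = r , refl , NW-suffix⁻ A C r j′ below nw

≥-lowLast : ∀ B k b → All (k <_) B → b < length (B ∷ʳ k) → k ≤ at (B ∷ʳ k) b
≥-lowLast B k b k<B bl with <-∷ʳ-split B k b bl
... | inj₁ p    = subst (k ≤_) (sym (at-++ˡ B [ k ] b p)) (<⇒≤ (at-All B b k<B p))
... | inj₂ refl = subst (k ≤_) (sym (at-∷ʳ B k)) ≤-refl

≤-highLast : ∀ A k b → All (_< k) A → b < length (A ∷ʳ k) → at (A ∷ʳ k) b ≤ k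
≤-highLast A k b A<k bl with <-∷ʳ-split A k b bl
... | inj₁ p    = subst (_≤ k) (sym (at-++ˡ A [ k ] b p)) (<⇒≤ (at-All A b A<k p))
... | inj₂ refl = subst (_≤ k) (sym (at-∷ʳ A k)) ≤-refl

shape-assemble : ∀ A B k M → All (_< k) A → All (k <_) B → StripeShape A M → StripeShape B M →
  (A ≡ [] → M k) → (∀ {x} → x ∈ A → ¬ M k) → StripeShape (A ++ B ∷ʳ k) M
shape-assemble []           B k M A<k k<B shapeA shapeB marked unmarked =
  shape-lowMarked B k M k<B shapeB (marked refl)
shape-assemble A@(a ∷ _) B k M A<k k<B shapeA shapeB marked unmarked =
  shape-++ A (B ∷ʳ k) M below (s≤s z≤n) shapeA
    (lowUnmarked-allLast B k M k<B shapeB (unmarked (here refl)))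
  where
  below : Below A (B ∷ʳ k)
  below x y xl yl = <-≤-trans (at-All A x A<k xl) (≥-lowLast B k y k<B yl)

-- Left-to-right minima of δ ++ α ++ [k].

LRMinValue : List ℕ → ℕ → Set
LRMinValue γ v = ∃[ p ] (at γ p ≡ v × LRMin γ p)

lrmin-last : ∀ δ k → All (k <_) δ → LRMinValue (δ ∷ʳ k) k
lrmin-last δ k k<δ = length δ , at-∷ʳ δ k ,
  subst (length δ <_) (sym (length-∷ʳ δ k)) ≤-refl ,
  λ a al → subst₂ _≤_ (sym (at-∷ʳ δ k)) (sym (at-++ˡ δ [ k ] a al)) (<⇒≤ (at-All δ a k<δ al))

module LRMinima (δ α : List ℕ) (k : ℕ) (k<δ : All (k <_) δ) (α<k : All (_< k) α) where
  γ = δ ++ α ∷ʳ k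

  α-below : ∀ a b → a < length δ → b < length (α ∷ʳ k) → at δ a ≥ at (α ∷ʳ k) b
  α-below a b al bl = <⇒≤ (≤-<-trans (≤-highLast α k b α<k bl) (at-All δ a k<δ al))

  lrmin-α⁻ : ∀ v → v < k → LRMinValue γ v → LRMinValue α v
  lrmin-α⁻ v v<k (p , e , lrmin) with p <? length δ
  ... | yes pl = ⊥-elim (<-asym v<k (subst (k <_) (trans (sym (at-++ˡ δ (α ∷ʳ k) p pl)) e)
                   (at-All δ p k<δ pl)))
  ... | no pl with ≤⇒offset (length δ) p (≮⇒≥ pl)
  ... | p′ , refl = inα (p′ <? length α)
    where
    lrmin′ : LRMin (α ∷ʳ k) p′
    lrmin′ = LR-suffix⁻ {_≥_} δ (α ∷ʳ k) p′ lrmin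
    e′ : at (α ∷ʳ k) p′ ≡ v
    e′ = trans (sym (at-++ʳ δ (α ∷ʳ k) p′)) e
    inα : Dec (p′ < length α) → LRMinValue α v
    inα (yes pl′) = p′ , trans (sym (at-++ˡ α [ k ] p′ pl′)) e′ , LR-prefix⁻ {_≥_} α [ k ] p′ pl′ lrmin′
    inα (no pl′) with <-∷ʳ-split α k p′ (proj₁ lrmin′)
    ... | inj₁ x    = ⊥-elim (pl′ x)
    ... | inj₂ refl = ⊥-elim (<-irrefl (sym (trans (sym (at-∷ʳ α k)) e′)) v<k)

  lrmin-α⁺ : ∀ v → LRMinValue α v → LRMinValue γ v
  lrmin-α⁺ v (p , e , lrmin) = length δ + p ,
    trans (at-++ʳ δ (α ∷ʳ k) p) (trans (at-++ˡ α [ k ] p (proj₁ lrmin)) e) ,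
    LR-suffix⁺ {_≥_} δ (α ∷ʳ k) p α-below (LR-prefix⁺ {_≥_} α [ k ] p lrmin)

  lrmin-δ⁻ : ∀ v → k < v → LRMinValue γ v → LRMinValue δ v
  lrmin-δ⁻ v k<v (p , e , lrmin) with p <? length δ
  ... | yes pl = p , trans (sym (at-++ˡ δ (α ∷ʳ k) p pl)) e , LR-prefix⁻ {_≥_} δ (α ∷ʳ k) p pl lrmin
  ... | no pl with ≤⇒offset (length δ) p (≮⇒≥ pl)
  ... | p′ , refl = ⊥-elim (<⇒≱ k<v (subst (_≤ k) (trans (sym (at-++ʳ δ (α ∷ʳ k) p′)) e)
                      (≤-highLast α k p′ α<k (offset-<⁻ δ (α ∷ʳ k) p′ (proj₁ lrmin)))))

  lrmin-δ⁺ : ∀ v → LRMinValue δ v → LRMinValue γ v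
  lrmin-δ⁺ v (p , e , lrmin) = p , trans (at-++ˡ δ (α ∷ʳ k) p (proj₁ lrmin)) e , LR-prefix⁺ {_≥_} δ (α ∷ʳ k) p lrmin

  lrmin-k⁻ : 0 < length α → ¬ LRMinValue γ k
  lrmin-k⁻ 0<α (p , e , lrmin) with p <? length δ
  ... | yes pl = <-irrefl (sym (trans (sym (at-++ˡ δ (α ∷ʳ k) p pl)) e)) (at-All δ p k<δ pl)
  ... | no pl with ≤⇒offset (length δ) p (≮⇒≥ pl)
  ... | p′ , refl = notInSuffix p′ (LR-suffix⁻ {_≥_} δ (α ∷ʳ k) p′ lrmin) (trans (sym (at-++ʳ δ (α ∷ʳ k) p′)) e)
    where
    first<k : at (α ∷ʳ k) 0 < k
    first<k = subst (_< k) (sym (at-++ˡ α [ k ] 0 0<α)) (at-All α 0 α<k 0<α)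
    notInSuffix : ∀ p′ → LRMin (α ∷ʳ k) p′ → at (α ∷ʳ k) p′ ≡ k → ⊥
    notInSuffix zero     _              e′ = <-irrefl e′ first<k
    notInSuffix (suc p″) (_ , earlier) e′ = <⇒≱ first<k (subst (_≤ at (α ∷ʳ k) 0) e′ (earlier 0 (s≤s z≤n)))

-- Computing swl.

swlBy : List ℕ → List ℕ → List ℕ
swlBy vs xs = foldr swlStep xs vs

notValue : (i : ℕ) → Decidable (λ x → ¬ (x ≡ i))
notValue i x = ¬? (x ≟ i)

span-hit : ∀ i zs → span (notValue i) (i ∷ zs) ≡ ([] , i ∷ zs)
span-hit i zs with i ≡ᵇ i in eq
... | true  = refl
... | false = ⊥-elim (subst T eq (≡⇒≡ᵇ i i refl))

span-miss : ∀ i z zs → ¬ z ≡ i →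
  span (notValue i) (z ∷ zs) ≡ (z ∷ proj₁ (span (notValue i) zs) , proj₂ (span (notValue i) zs))
span-miss i z zs z≢i with z ≡ᵇ i in eq
... | true  = ⊥-elim (z≢i (≡ᵇ⇒≡ z i (subst T (sym eq) tt)))
... | false = refl

span-split : ∀ i xs → xs ≡ proj₁ (span (notValue i) xs) ++ proj₂ (span (notValue i) xs) ×
  All (λ x → ¬ x ≡ i) (proj₁ (span (notValue i) xs))
span-split i []       = refl , []
span-split i (x ∷ xs) with x ≟ i
... | yes refl rewrite span-hit x xs = refl , []
... | no x≢i rewrite span-miss i x xs x≢i =
  cong (x ∷_) (proj₁ (span-split i xs)) , x≢i ∷ proj₂ (span-split i xs)

span-stop : ∀ k zs ys → All (λ x → ¬ x ≡ k) zs → span (notValue k) (zs ++ k ∷ ys) ≡ (zs , k ∷ ys)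
span-stop k []       ys _            = span-hit k ys
span-stop k (z ∷ zs) ys (z≢k ∷ zs≢k)
  rewrite span-miss k z (zs ++ k ∷ ys) z≢k | span-stop k zs ys zs≢k = refl

span-++ : ∀ i zs ys → i ∈ zs →
  span (notValue i) (zs ++ ys) ≡ (proj₁ (span (notValue i) zs) , proj₂ (span (notValue i) zs) ++ ys)
span-++ i (z ∷ zs) ys i∈ with z ≟ i
... | yes refl rewrite span-hit z (zs ++ ys) | span-hit z zs = refl
... | no z≢i with i∈
... | here e    = ⊥-elim (z≢i (sym e))
... | there i∈′ rewrite span-miss i z (zs ++ ys) z≢i | span-miss i z zs z≢i | span-++ i zs ys i∈′ = refl

-- swl_i only moves entries to the left of i, so it commutes with appending.
swlStep-++ : ∀ i zs ys → i ∈ zs → swlStep i (zs ++ ys) ≡ swlStep i zs ++ ys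
swlStep-++ i zs ys i∈ rewrite span-++ i zs ys i∈ =
  trans (cong (filter (_<? i) pre ++_) (sym (++-assoc (filter (i <?_) pre) rest ys)))
        (sym (++-assoc (filter (_<? i) pre) (filter (i <?_) pre ++ rest) ys))
  where
  pre = proj₁ (span (notValue i) zs)
  rest = proj₂ (span (notValue i) zs)

∈-swlStep⁻ : ∀ i {x} xs → x ∈ swlStep i xs → x ∈ xs
∈-swlStep⁻ i {x} xs x∈ = subst (x ∈_) (sym (proj₁ (span-split i xs))) (fromParts (∈-++⁻ (filter (_<? i) pre) x∈))
  where
  pre = proj₁ (span (notValue i) xs)
  rest = proj₂ (span (notValue i) xs)
  fromParts : x ∈ filter (_<? i) pre ⊎ x ∈ filter (i <?_) pre ++ rest → x ∈ pre ++ rest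
  fromParts (inj₁ x∈′) = ∈-++⁺ˡ {ys = rest} (proj₁ (∈-filter⁻ (_<? i) x∈′))
  fromParts (inj₂ x∈′) with ∈-++⁻ (filter (i <?_) pre) x∈′
  ... | inj₁ x∈″ = ∈-++⁺ˡ {ys = rest} (proj₁ (∈-filter⁻ (i <?_) x∈″))
  ... | inj₂ x∈″ = ∈-++⁺ʳ pre x∈″

∈-swlStep⁺ : ∀ i {x} xs → x ∈ xs → x ∈ swlStep i xs
∈-swlStep⁺ i {x} xs x∈ = toParts (∈-++⁻ pre (subst (x ∈_) (proj₁ (span-split i xs)) x∈))
  where
  pre = proj₁ (span (notValue i) xs)
  rest = proj₂ (span (notValue i) xs)
  toParts : x ∈ pre ⊎ x ∈ rest → x ∈ swlStep i xs
  toParts (inj₁ x∈′) with <-cmp x i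
  ... | tri< x<i _ _ = ∈-++⁺ˡ {ys = filter (i <?_) pre ++ rest} (∈-filter⁺ (_<? i) x∈′ x<i)
  ... | tri≈ _ x≡i _ = ⊥-elim (All.lookup (proj₂ (span-split i xs)) x∈′ x≡i)
  ... | tri> _ _ i<x = ∈-++⁺ʳ (filter (_<? i) pre) (∈-++⁺ˡ {ys = rest} (∈-filter⁺ (i <?_) x∈′ i<x))
  toParts (inj₂ x∈′) = ∈-++⁺ʳ (filter (_<? i) pre) (∈-++⁺ʳ (filter (i <?_) pre) x∈′)

∈-swlBy⁻ : ∀ vs {x} xs → x ∈ swlBy vs xs → x ∈ xs
∈-swlBy⁻ []       xs x∈ = x∈
∈-swlBy⁻ (v ∷ vs) xs x∈ = ∈-swlBy⁻ vs xs (∈-swlStep⁻ v (swlBy vs xs) x∈)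

∈-swlBy⁺ : ∀ vs {x} xs → x ∈ xs → x ∈ swlBy vs xs
∈-swlBy⁺ []       xs x∈ = x∈
∈-swlBy⁺ (v ∷ vs) xs x∈ = ∈-swlStep⁺ v (swlBy vs xs) (∈-swlBy⁺ vs xs x∈)

swlBy-[] : ∀ vs → swlBy vs [] ≡ []
swlBy-[] []       = refl
swlBy-[] (v ∷ vs) rewrite swlBy-[] vs = refl

swlBy-++ : ∀ vs xs ys → All (_∈ xs) vs → swlBy vs (xs ++ ys) ≡ swlBy vs xs ++ ys
swlBy-++ []       xs ys _            = refl
swlBy-++ (v ∷ vs) xs ys (v∈ ∷ vs∈) rewrite swlBy-++ vs xs ys vs∈ =
  swlStep-++ v (swlBy vs xs) ys (∈-swlBy⁺ vs xs v∈)

sorted-split : ∀ vs k → AllPairs _<_ vs → k ∈ vs → vs ≡ filter (_<? k) vs ++ k ∷ filter (k <?_) vs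
sorted-split (x ∷ xs) .x (x<xs ∷ _) (here refl)
  rewrite filter-reject (_<? x) {x} {xs} (n≮n x)
        | filter-none (_<? x) {xs} (All.map (λ x<y → <-asym x<y) x<xs)
        | filter-reject (x <?_) {x} {xs} (n≮n x)
        | filter-all (x <?_) {xs} x<xs = refl
sorted-split (x ∷ xs) k (x<xs ∷ sorted) (there k∈)
  rewrite filter-accept (_<? k) {x} {xs} (All.lookup x<xs k∈)
        | filter-reject (k <?_) {x} {xs} (<-asym (All.lookup x<xs k∈)) =
  cong (x ∷_) (sorted-split xs k sorted k∈)

below-in-α : ∀ δ α k {x} → All (k <_) δ → x ∈ δ ++ α ∷ʳ k → x < k → x ∈ α
below-in-α δ α k k<δ x∈ x<k with ∈-++⁻ δ x∈
... | inj₁ x∈δ = ⊥-elim (<-asym x<k (All.lookup k<δ x∈δ))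
... | inj₂ x∈′ with ∈-++⁻ α x∈′
... | inj₁ x∈α         = x∈α
... | inj₂ (here refl) = ⊥-elim (n≮n k x<k)

above-in-δ : ∀ δ α k {x} → All (_< k) α → x ∈ δ ++ α ∷ʳ k → k < x → x ∈ δ
above-in-δ δ α k α<k x∈ k<x with ∈-++⁻ δ x∈
... | inj₁ x∈δ = x∈δ
... | inj₂ x∈′ with ∈-++⁻ α x∈′
... | inj₁ x∈α         = ⊥-elim (<-asym k<x (All.lookup α<k x∈α))
... | inj₂ (here refl) = ⊥-elim (n≮n k k<x)

swlStep-lowFirst : ∀ D α k → All (k <_) D → All (_< k) α → swlStep k (D ++ α ∷ʳ k) ≡ α ++ D ∷ʳ k
swlStep-lowFirst D α k k<D α<k
  rewrite sym (++-assoc D α [ k ])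
        | span-stop k (D ++ α) [] (AllP.++⁺ (All.map (λ k<x x≡k → <-irrefl (sym x≡k) k<x) k<D)
                                             (All.map (λ x<k x≡k → <-irrefl x≡k x<k) α<k))
        | filter-++ (_<? k) D α | filter-++ (k <?_) D α
        | filter-none (_<? k) {D} (All.map (λ k<x → <-asym k<x) k<D)
        | filter-all (_<? k) {α} α<k
        | filter-all (k <?_) {D} k<D
        | filter-none (k <?_) {α} (All.map (λ x<k → <-asym x<k) α<k)
        | ++-identityʳ D = refl

swl-split : ∀ vs δ α k → AllPairs _<_ vs → (∀ {x} → x ∈ vs → x ∈ δ ++ α ∷ʳ k) → k ∈ vs →
  All (k <_) δ → All (_< k) α →
  swlBy vs (δ ++ α ∷ʳ k) ≡ swlBy (filter (_<? k) vs) α ++ swlBy (filter (k <?_) vs) δ ∷ʳ k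
swl-split vs δ α k sorted values k∈vs k<δ α<k =
  begin
    swlBy vs (δ ++ α ∷ʳ k)
  ≡⟨ cong (λ ws → swlBy ws (δ ++ α ∷ʳ k)) (sorted-split vs k sorted k∈vs) ⟩
    swlBy (vs< ++ k ∷ vs>) (δ ++ α ∷ʳ k)
  ≡⟨ foldr-++ swlStep (δ ++ α ∷ʳ k) vs< (k ∷ vs>) ⟩
    swlBy vs< (swlStep k (swlBy vs> (δ ++ α ∷ʳ k)))
  ≡⟨ cong (λ xs → swlBy vs< (swlStep k xs)) (swlBy-++ vs> δ (α ∷ʳ k) vs>∈δ) ⟩
    swlBy vs< (swlStep k (swlBy vs> δ ++ α ∷ʳ k))
  ≡⟨ cong (swlBy vs<) (swlStep-lowFirst (swlBy vs> δ) α k k<D α<k) ⟩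
    swlBy vs< (α ++ swlBy vs> δ ∷ʳ k)
  ≡⟨ swlBy-++ vs< α (swlBy vs> δ ∷ʳ k) vs<∈α ⟩
    swlBy vs< α ++ swlBy vs> δ ∷ʳ k
  ∎
  where
  open ≡-Reasoning
  vs< = filter (_<? k) vs
  vs> = filter (k <?_) vs
  vs>∈δ : All (_∈ δ) vs>
  vs>∈δ = All.tabulate λ x∈ → let (x∈vs , k<x) = ∈-filter⁻ (k <?_) x∈ in above-in-δ δ α k α<k (values x∈vs) k<x
  vs<∈α : All (_∈ α) vs<
  vs<∈α = All.tabulate λ x∈ → let (x∈vs , x<k) = ∈-filter⁻ (_<? k) x∈ in below-in-α δ α k k<δ (values x∈vs) x<k
  k<D : All (k <_) (swlBy vs> δ)
  k<D = All.tabulate λ x∈ → All.lookup k<δ (∈-swlBy⁻ vs> δ x∈)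

avoids132-tail : ∀ x xs → Avoids132 (x ∷ xs) → Avoids132 xs
avoids132-tail x xs av a b c a<b b<c cl = av (suc a) (suc b) (suc c) (s≤s a<b) (s≤s b<c) (s≤s cl)

avoids132-suffix : ∀ xs ys → Avoids132 (xs ++ ys) → Avoids132 ys
avoids132-suffix []       ys av = av
avoids132-suffix (x ∷ xs) ys av = avoids132-suffix xs ys (avoids132-tail x (xs ++ ys) av)

avoids132-prefix : ∀ xs ys → Avoids132 (xs ++ ys) → Avoids132 xs
avoids132-prefix xs ys av a b c a<b b<c cl (ac , cb) =
  av a b c a<b b<c (<-≤-trans cl (length-++-≤ˡ xs))
    (subst₂ _<_ (sym (at-++ˡ xs ys a al)) (sym (at-++ˡ xs ys c cl)) ac ,
     subst₂ _<_ (sym (at-++ˡ xs ys c cl)) (sym (at-++ˡ xs ys b bl)) cb)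
  where
  bl = <-trans b<c cl
  al = <-trans a<b bl

-- A 132-avoider γ′ ++ [k] (k not in γ′) is δ ++ α ++ [k] with δ above and α
-- below k: an entry x < k before an entry d > k would give the 132 x d k.
avoids132-split : ∀ γ′ k → All (λ x → ¬ x ≡ k) γ′ → Avoids132 (γ′ ∷ʳ k) →
  Σ (List ℕ) λ δ → Σ (List ℕ) λ α → γ′ ≡ δ ++ α × All (k <_) δ × All (_< k) α
avoids132-split []      k _             _  = [] , [] , refl , [] , []
avoids132-split (x ∷ r) k (x≢k ∷ r≢k) av
  with avoids132-split r k r≢k (avoids132-tail x (r ∷ʳ k) av)
... | d ∷ δ′ , α′ , refl , k<d ∷ k<δ′ , α′<k with <-cmp x k
...   | tri< x<k _ _ = ⊥-elim (av 0 1 (length (x ∷ d ∷ δ′ ++ α′)) (s≤s z≤n) (s≤s (s≤s z≤n))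
          (subst (length (x ∷ d ∷ δ′ ++ α′) <_) (sym (length-∷ʳ (x ∷ d ∷ δ′ ++ α′) k)) ≤-refl)
          (subst (x <_) (sym (at-∷ʳ (x ∷ d ∷ δ′ ++ α′) k)) x<k ,
           subst (_< d) (sym (at-∷ʳ (x ∷ d ∷ δ′ ++ α′) k)) k<d))
...   | tri≈ _ x≡k _ = ⊥-elim (x≢k x≡k)
...   | tri> _ _ k<x = x ∷ d ∷ δ′ , α′ , refl , k<x ∷ k<d ∷ k<δ′ , α′<k
avoids132-split (x ∷ r) k (x≢k ∷ r≢k) av | [] , α′ , refl , [] , α′<k with <-cmp x k
...   | tri< x<k _ _ = [] , x ∷ α′ , refl , [] , x<k ∷ α′<k
...   | tri≈ _ x≡k _ = ⊥-elim (x≢k x≡k)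
...   | tri> _ _ k<x = [ x ] , α′ , refl , k<x ∷ [] , α′<k

AllPairs-++⁻ : ∀ {R : ℕ → ℕ → Set} xs ys → AllPairs R (xs ++ ys) →
  AllPairs R xs × AllPairs R ys × All (λ x → All (R x) ys) xs
AllPairs-++⁻ []       ys pairs = [] , pairs , []
AllPairs-++⁻ (x ∷ xs) ys (x~ ∷ pairs) with AllPairs-++⁻ xs ys pairs | AllP.++⁻ xs x~
... | xs~ , ys~ , across | x~xs , x~ys = (x~xs ∷ xs~) , ys~ , (x~ys ∷ across)

last-fresh : ∀ γ′ k → Unique (γ′ ∷ʳ k) → All (λ x → ¬ x ≡ k) γ′
last-fresh γ′ k u = All.map (λ { (x≢k ∷ []) → x≢k }) (proj₂ (proj₂ (AllPairs-++⁻ γ′ [ k ] u)))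

SortedSupport : List ℕ → List ℕ → Set
SortedSupport vs γ = AllPairs _<_ vs × (∀ {x} → x ∈ vs → x ∈ γ) × (∀ {x} → x ∈ γ → x ∈ vs)

support-below : ∀ vs δ α k → All (k <_) δ → All (_< k) α →
  SortedSupport vs (δ ++ α ∷ʳ k) → SortedSupport (filter (_<? k) vs) α
support-below vs δ α k k<δ α<k (sorted , vs⊆ , ⊆vs) =
  AllPairsP.filter⁺ (_<? k) sorted ,
  (λ x∈ → let (x∈vs , x<k) = ∈-filter⁻ (_<? k) x∈ in below-in-α δ α k k<δ (vs⊆ x∈vs) x<k) ,
  (λ x∈ → ∈-filter⁺ (_<? k) (⊆vs (∈-++⁺ʳ δ (∈-++⁺ˡ x∈))) (All.lookup α<k x∈))

support-above : ∀ vs δ α k → All (k <_) δ → All (_< k) α →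
  SortedSupport vs (δ ++ α ∷ʳ k) → SortedSupport (filter (k <?_) vs) δ
support-above vs δ α k k<δ α<k (sorted , vs⊆ , ⊆vs) =
  AllPairsP.filter⁺ (k <?_) sorted ,
  (λ x∈ → let (x∈vs , k<x) = ∈-filter⁻ (k <?_) x∈ in above-in-δ δ α k α<k (vs⊆ x∈vs) k<x) ,
  (λ x∈ → ∈-filter⁺ (k <?_) (⊆vs (∈-++⁺ˡ x∈)) (All.lookup k<δ x∈))

lrmin-k-ifEmpty : ∀ δ α k vs → All (k <_) δ → swlBy vs α ≡ [] → LRMinValue (δ ++ α ∷ʳ k) k
lrmin-k-ifEmpty δ []      k vs k<δ _  = lrmin-last δ k k<δ
lrmin-k-ifEmpty δ (a ∷ α) k vs k<δ e with subst (a ∈_) e (∈-swlBy⁺ vs (a ∷ α) (here refl))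
... | ()

shape-split : ∀ vs δ α k → All (k <_) δ → All (_< k) α → SortedSupport vs (δ ++ α ∷ʳ k) →
  StripeShape (swlBy (filter (_<? k) vs) α) (LRMinValue α) →
  StripeShape (swlBy (filter (k <?_) vs) δ) (LRMinValue δ) →
  StripeShape (swlBy vs (δ ++ α ∷ʳ k)) (LRMinValue (δ ++ α ∷ʳ k))
shape-split vs δ α k k<δ α<k (sorted , vs⊆ , ⊆vs) shapeα shapeδ =
  subst (λ π → StripeShape π M) (sym (swl-split vs δ α k sorted vs⊆ k∈vs k<δ α<k))
    (shape-assemble A B k M A<k k<B
      (shape-respects A (LRMinValue α) M (λ {v} _ → lrmin-α⁺ v) (λ {v} v∈ → lrmin-α⁻ v (All.lookup A<k v∈)) shapeα)
      (shape-respects B (LRMinValue δ) M (λ {v} _ → lrmin-δ⁺ v) (λ {v} v∈ → lrmin-δ⁻ v (All.lookup k<B v∈)) shapeδ)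
      (lrmin-k-ifEmpty δ α k vs< k<δ)
      (λ x∈ → lrmin-k⁻ (∈⇒nonEmpty (∈-swlBy⁻ vs< α x∈))))
  where
  open LRMinima δ α k k<δ α<k
  M = LRMinValue (δ ++ α ∷ʳ k)
  vs< = filter (_<? k) vs
  vs> = filter (k <?_) vs
  A = swlBy vs< α
  B = swlBy vs> δ
  k∈vs : k ∈ vs
  k∈vs = ⊆vs (∈-++⁺ʳ δ (∈-++⁺ʳ α (here refl)))
  A<k : All (_< k) A
  A<k = All.tabulate λ x∈ → All.lookup α<k (∈-swlBy⁻ vs< α x∈)
  k<B : All (k <_) B
  k<B = All.tabulate λ x∈ → All.lookup k<δ (∈-swlBy⁻ vs> δ x∈)

shorter-blocks : ∀ (δ α : List ℕ) k →
  length δ < length (δ ++ α ∷ʳ k) × length α < length (δ ++ α ∷ʳ k)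
shorter-blocks δ α k rewrite length-++ δ {α ∷ʳ k} | length-∷ʳ α k =
  m<m+n (length δ) (s≤s z≤n) , m≤n+m (suc (length α)) (length δ)

shape-swl : ∀ bound γ vs → length γ < bound → SortedSupport vs γ → Unique γ → Avoids132 γ →
  StripeShape (swlBy vs γ) (LRMinValue γ)
shape-swl (suc n) γ vs γ<n support u av with initLast γ
... | [] = subst (λ π → StripeShape π (LRMinValue [])) (sym (swlBy-[] vs)) (shape-[] (LRMinValue []))
... | γ′ ∷ʳ′ k with avoids132-split γ′ k (last-fresh γ′ k u) av
... | δ , α , refl , k<δ , α<k =
  subst Claim (sym (++-assoc δ α [ k ])) blocks γ<n support u av
  where
  Claim : List ℕ → Set
  Claim γ = length γ < suc n → SortedSupport vs γ → Unique γ → Avoids132 γ →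
    StripeShape (swlBy vs γ) (LRMinValue γ)
  blocks : Claim (δ ++ α ∷ʳ k)
  blocks γ<n support u av =
    shape-split vs δ α k k<δ α<k support
      (shape-swl n α (filter (_<? k) vs) (<-≤-trans α< (≤-pred γ<n))
        (support-below vs δ α k k<δ α<k support) uα
        (avoids132-prefix α [ k ] (avoids132-suffix δ (α ∷ʳ k) av)))
      (shape-swl n δ (filter (k <?_) vs) (<-≤-trans δ< (≤-pred γ<n))
        (support-above vs δ α k k<δ α<k support) uδ (avoids132-prefix δ (α ∷ʳ k) av))
    where
    δ< = proj₁ (shorter-blocks δ α k)
    α< = proj₂ (shorter-blocks δ α k)
    uδ = proj₁ (AllPairs-++⁻ δ (α ∷ʳ k) u)
    uα = proj₁ (AllPairs-++⁻ α [ k ] (proj₁ (proj₂ (AllPairs-++⁻ δ (α ∷ʳ k) u))))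

perm-support : ∀ τ → IsPerm τ → SortedSupport (map suc (upTo (length τ))) τ
perm-support τ perm =
  AllPairsP.map⁺ (AllPairsP.applyUpTo⁺₁ (λ x → x) (length τ) (λ i<j _ → s≤s i<j)) ,
  ∈-resp-↭ (↭-sym perm) , ∈-resp-↭ perm

perm-unique : ∀ τ → IsPerm τ → Unique τ
perm-unique τ perm =
  Unique-resp-↭ (↭⇒↭ₛ (↭-sym perm)) (AllPairs.map <⇒≢ (proj₁ (perm-support τ perm)))

lowestHead⇒first : ∀ π j → StripeHead π j → (∀ j′ → StripeHead π j′ → at π j ≤ at π j′) → j ≡ 0
lowestHead⇒first π zero    _    _      = refl
lowestHead⇒first π (suc j) head lowest =
  ⊥-elim (leftmost 0 (s≤s z≤n) (LRMax-first π 0<π) (lowest 0 firstHead))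
  where
  leftmost = proj₂ (proj₂ (proj₂ (proj₂ head)))
  0<π : 0 < length π
  0<π = ≤-<-trans z≤n (NW-inRange π head)
  firstHead : StripeHead π 0
  firstHead = 0<π , LRMax-first π 0<π , z≤n , ≤-refl , λ _ ()

notLowest⇒pos : ∀ π j → (∃[ j′ ] (StripeHead π j′ × at π j′ < at π j)) → 0 < j
notLowest⇒pos π zero    (j′ , (_ , lrmax , _) , lower) = ⊥-elim (<⇒≱ lower (first≤LRMax π j′ lrmax))
notLowest⇒pos π (suc j) _                             = s≤s z≤n

theorem6p7 : (τ : List ℕ) → IsPerm τ → Avoids132 τ →
    ∀ j → StripeHead (swl τ) j →
      ((∀ j′ → StripeHead (swl τ) j′ → at (swl τ) j ≤ at (swl τ) j′) →
        ∀ q → NW (swl τ) q j → ImgLRMin τ (swl τ) q)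
      ×
      ((∃[ j′ ] (StripeHead (swl τ) j′ × at (swl τ) j′ < at (swl τ) j)) →
        ∃[ q ] (NW (swl τ) q j × ¬ ImgLRMin τ (swl τ) q ×
          (∀ q′ → NW (swl τ) q′ j → ¬ ImgLRMin τ (swl τ) q′ → q′ ≡ q) ×
          (∀ q′ → NW (swl τ) q′ j → q′ ≤ q)))
theorem6p7 τ perm av j head = lowestStripe , higherStripe
  where
  π = swl τ
  shape : StripeShape π (LRMinValue τ)
  shape = shape-swl (suc (length τ)) τ (map suc (upTo (length τ))) ≤-refl
            (perm-support τ perm) (perm-unique τ perm) av
  lowestStripe : (∀ j′ → StripeHead π j′ → at π j ≤ at π j′) → ∀ q → NW π q j → ImgLRMin τ π q
  lowestStripe lowest q nw = proj₁ shape q (subst (NW π q) (lowestHead⇒first π j head lowest) nw)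
  higherStripe : (∃[ j′ ] (StripeHead π j′ × at π j′ < at π j)) → LastUnmarked π (LRMinValue τ) j
  higherStripe lower = proj₂ shape j head (notLowest⇒pos π j lower)
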